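{- Let $\mathcal F$ be an algebraic language with no nullary symbols and $\mathbf I=([m];\mathcal F)$ a finite $\mathcal F$-algebra ($m>0$). Then the assignments $(\mathbf A,\chi)\mapsto\mathfrak C(\mathbf A,\chi)$ and $\psi\mapsto\psi^{(1)}\times\dots\times\psi^{(m)}$ (where $\psi^{(i)}$ is the restriction of $\psi$ to $\chi^{ -1}(i)$) define an isomorphism of categories from $(\mathsf{Alg}(\mathcal F)\downdownarrows\mathbf I)$ onto the full subcategory of $\hat{\mathcal F}_{\mathbf I}$-algebras consisting of the algebras $\mathfrak C(\mathbf A,\chi)$; in particular, $(\mathsf{Alg}(\mathcal F)\downdownarrows\mathbf I)$ is equivalent to the category of nonempty members of the variety $\mathcal D(\hat{\mathcal F}_{\mathbf I})$.
   Context: $(\mathsf{Alg}(\mathcal F)\downdownarrows\mathbf I)$: objects are pairs $(\mathbf A,\chi)$ with $\mathbf A$ an $\mathcal F$-algebra and $\chi\colon\mathbf A\to\mathbf I$ a surjective homomorphism; morphisms $(\mathbf A,\chi)\to(\mathbf B,\xi)$ are homomorphisms $\psi$ with $\chi=\xi\circ\psi$. $\hat{\mathcal F}_{\mathbf I}$ has an $m$-ary symbol $d$ and for each $k$-ary $f\in\mathcal F$ and $\mathbf i=(i_1,\dots,i_k)\in[m]^k$ a $k$-ary symbol $\hat f_{\mathbf i}$. With $D^{(i)}=\chi^{ -1}(i)$, $\mathfrak C(\mathbf A,\chi)$ has universe $D^{(1)}\times\dots\times D^{(m)}$ (columns $\mathbf c=(c^{(1)},\dots,c^{(m)})$), $d(\mathbf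 c_1,\dots,\mathbf c_m)=(c_1^{(1)},\dots,c_m^{(m)})$, and $\hat f_{\mathbf i}(\mathbf c_1,\dots,\mathbf c_k)$ is $\mathbf c_1$ with its $f^{\mathbf I}(\mathbf i)$-th entry replaced by $f^{\mathbf A}(c_1^{(i_1)},\dots,c_k^{(i_k)})$. $\mathcal D(\hat{\mathcal F}_{\mathbf I})$ is the variety defined by $d(x,\dots,x)=x$, $d(d(x_{11},\dots,x_{1m}),\dots,d(x_{m1},\dots,x_{mm}))=d(x_{11},\dots,x_{mm})$, and for each symbol $\hat f_{\mathbf i}$ with $\mathbf i=(i_1,\dots,i_k)$ and $i'=f^{\mathbf I}(\mathbf i)$: $d_{i'}(\hat f_{\mathbf i}(x_1,\dots,x_k),y)=d_{i'}(\hat f_{\mathbf i}(d_{i_1}(x_1,v_1),\dots,d_{i_k}(x_k,v_k)),y)$ and $d_j(\hat f_{\mathbf i}(x_1,\dots,x_k),y)=d_j(x_1,y)$ for $j\ne i'$, where $d_\ell(x,u)=d(u,\dots,u,x,u,\dots,u)$ with $x$ in position $\ell$. -}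

module Defs where

open import Level using (Level; _⊔_) renaming (suc to lsuc; zero to lzero)
open import Data.Nat using (ℕ; zero; suc; _<_; s≤s; z≤n)
open import Data.Fin using (Fin; _≟_)
open import Data.Vec using (Vec; _∷_; []; lookup; tabulate; map; replicate; _[_]≔_)
open import Data.Vec.Properties using (tabulate-∘; tabulate-cong; tabulate∘lookup)
open import Data.Product using (Σ; _,_; proj₁; proj₂; _×_)
open import Relation.Binary.Core using (Rel)
open import Relation.Binary.Structures using (IsEquivalence)
open import Relation.Binary.PropositionalEquality using (_≡_; refl; sym; trans; cong; subst)
open import Relation.Nullary using (¬_; yes; no)
open import Function using (_∘_; id)

record Language : Set₁ where
  field
    Sym   : Set
    arity : Sym → ℕ
open Language public

NoNullary : Language → Set
NoNullary F = ∀ f → 0 < arity F f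

record Algebra (F : Language) (a ℓ : Level) : Set (lsuc (a ⊔ ℓ)) where
  field
    Carrier       : Set a
    _≈_           : Rel Carrier ℓ
    isEquivalence : IsEquivalence _≈_
    op            : (f : Sym F) → Vec Carrier (arity F f) → Carrier
    op-cong       : ∀ f {xs ys : Vec Carrier (arity F f)} →
                    (∀ k → lookup xs k ≈ lookup ys k) → op f xs ≈ op f ys
open Algebra public

record Hom {F : Language} {a ℓ b ℓ'} (A : Algebra F a ℓ) (B : Algebra F b ℓ')
       : Set (a ⊔ ℓ ⊔ b ⊔ ℓ') where
  field
    fun     : Carrier A → Carrier B
    fun-cong : ∀ {x y} → _≈_ A x y → _≈_ B (fun x) (fun y)
    fun-hom : ∀ f (xs : Vec (Carrier A) (arity F f)) →
              _≈_ B (fun (op A f xs)) (op B f (map fun xs))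
open Hom public

IsHom : {F : Language} {a ℓ b ℓ' : Level} (A : Algebra F a ℓ) (B : Algebra F b ℓ') →
        (Carrier A → Carrier B) → Set (a ⊔ ℓ ⊔ ℓ')
IsHom {F} A B h = (∀ {x y} → _≈_ A x y → _≈_ B (h x) (h y))
                × (∀ f (xs : Vec (Carrier A) (arity F f)) →
                     _≈_ B (h (op A f xs)) (op B f (map h xs)))

record _≅_ {F : Language} {a ℓ b ℓ'} (A : Algebra F a ℓ) (B : Algebra F b ℓ')
       : Set (a ⊔ ℓ ⊔ b ⊔ ℓ') where
  field
    to      : Hom A B
    from    : Hom B A
    from∘to : ∀ x → _≈_ A (fun from (fun to x)) x
    to∘from : ∀ y → _≈_ B (fun to (fun from y)) y

head′ : ∀ {a} {A : Set a} {n} → 0 < n → Vec A n → A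
head′ {n = suc n} _ (x ∷ _) = x

private
  mapTab : ∀ {a} {A : Set a} {m n} (χ : A → Fin m) (g : Fin n → A) (is : Vec (Fin m) n) →
           (∀ k → χ (g k) ≡ lookup is k) → map χ (tabulate g) ≡ is
  mapTab χ g is p = trans (sym (tabulate-∘ χ g)) (trans (tabulate-cong p) (tabulate∘lookup is))

module Setup (F : Language) (nn : NoNullary F) (m : ℕ)
             (I : (f : Sym F) → Vec (Fin m) (arity F f) → Fin m) where

  -- Objects of (Alg(F) ⇊ I): an F-algebra with a surjective hom onto I
  record SliceObj (a ℓ : Level) : Set (lsuc (a ⊔ ℓ)) where
    field
      alg    : Algebra F a ℓ
      χ      : Carrier alg → Fin m
      χ-cong : ∀ {x y} → _≈_ alg x y → χ x ≡ χ y
      χ-hom  : ∀ f (xs : Vec (Carrier alg) (arity F f)) → χ (op alg f xs) ≡ I f (map χ xs)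
      χ-surj : ∀ (i : Fin m) → Σ (Carrier alg) (λ x → χ x ≡ i)
  open SliceObj public

  record SliceHom {a ℓ b ℓ'} (A : SliceObj a ℓ) (B : SliceObj b ℓ') : Set (a ⊔ ℓ ⊔ b ⊔ ℓ') where
    field
      hom : Hom (alg A) (alg B)
      tri : ∀ x → χ A x ≡ χ B (fun hom x)
  open SliceHom public

  sliceId : ∀ {a ℓ} (A : SliceObj a ℓ) → Carrier (alg A) → Carrier (alg A)
  sliceId A = id

  _≈ₛ_ : ∀ {a ℓ b ℓ'} {A : SliceObj a ℓ} {B : SliceObj b ℓ'} → Rel (SliceHom A B) (a ⊔ ℓ')
  _≈ₛ_ {B = B} ψ ψ′ = ∀ x → _≈_ (alg B) (fun (hom ψ) x) (fun (hom ψ′) x)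

  data HatSym : Set where
    d    : HatSym
    fhat : (f : Sym F) → Vec (Fin m) (arity F f) → HatSym

  hatArity : HatSym → ℕ
  hatArity d          = m
  hatArity (fhat f _) = arity F f

  F̂ : Language
  F̂ = record { Sym = HatSym ; arity = hatArity }

  dAt : ∀ {b ℓ'} (B : Algebra F̂ b ℓ') → Fin m → Carrier B → Carrier B → Carrier B
  dAt B j x u = op B d (replicate m u [ j ]≔ x)

  record InD {b ℓ'} (B : Algebra F̂ b ℓ') : Set (b ⊔ ℓ') where
    field
      idem : ∀ x → _≈_ B (op B d (replicate m x)) x
      diag : ∀ (X : Vec (Vec (Carrier B) m) m) →
             _≈_ B (op B d (map (op B d) X)) (op B d (tabulate (λ i → lookup (lookup X i) i)))
      hat-main : ∀ f (is : Vec (Fin m) (arity F f)) (xs vs : Vec (Carrier B) (arity F f)) y →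
             _≈_ B (dAt B (I f is) (op B (fhat f is) xs) y)
                   (dAt B (I f is)
                      (op B (fhat f is)
                         (tabulate (λ k → dAt B (lookup is k) (lookup xs k) (lookup vs k))))
                      y)
      hat-other : ∀ f (is : Vec (Fin m) (arity F f)) (j : Fin m) → ¬ (j ≡ I f is) →
             ∀ (xs : Vec (Carrier B) (arity F f)) y →
             _≈_ B (dAt B j (op B (fhat f is) xs) y) (dAt B j (head′ (nn f) xs) y)

  record NonemptyD (b ℓ' : Level) : Set (lsuc (b ⊔ ℓ')) where
    field
      algD     : Algebra F̂ b ℓ'
      inD      : InD algD
      inhabited : Carrier algD
  open NonemptyD public

  module _ {a ℓ} (A : SliceObj a ℓ) where
    private
      Aa = alg A
      open IsEquivalence (isEquivalence Aa) using () renaming (refl to ≈refl)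

    Fiber : Fin m → Set a
    Fiber i = Σ (Carrier Aa) (λ x → χ A x ≡ i)

    Column : Set a
    Column = (i : Fin m) → Fiber i

    _≈c_ : Rel Column ℓ
    c ≈c c′ = ∀ i → _≈_ Aa (proj₁ (c i)) (proj₁ (c′ i))

    hatArgs : ∀ f (is : Vec (Fin m) (arity F f)) → Vec Column (arity F f) → Vec (Carrier Aa) (arity F f)
    hatArgs f is cs = tabulate (λ k → proj₁ (lookup cs k (lookup is k)))

    hatVal : ∀ f (is : Vec (Fin m) (arity F f)) → Vec Column (arity F f) → Fiber (I f is)
    hatVal f is cs = op Aa f (hatArgs f is cs)
                   , trans (χ-hom A f _) (cong (I f) (mapTab (χ A) _ is (λ k → proj₂ (lookup cs k (lookup is k)))))

    ℭop : (s : HatSym) → Vec Column (hatArity s) → Column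
    ℭop d          cs i = lookup cs i i
    ℭop (fhat f is) cs j with j ≟ I f is
    ... | yes eq = subst Fiber (sym eq) (hatVal f is cs)
    ... | no _   = head′ (nn f) cs j

    private
      substFst : ∀ {i j} (eq : i ≡ j) (x : Fiber i) → proj₁ (subst Fiber eq x) ≡ proj₁ x
      substFst refl x = refl

      headCong : ∀ {n} (p : 0 < n) {xs ys : Vec Column n} →
                 (∀ k → lookup xs k ≈c lookup ys k) → head′ p xs ≈c head′ p ys
      headCong {suc n} p {x ∷ xs} {y ∷ ys} q = q Fin.zero
        where import Data.Fin as Fin

      ≈≡ : ∀ {x y} → x ≡ y → _≈_ Aa x y
      ≈≡ refl = ≈refl

      open IsEquivalence (isEquivalence Aa) using () renaming (trans to ≈trans; sym to ≈sym)

      lookupTab : ∀ {n} (g : Fin n → Carrier Aa) k → lookup (tabulate g) k ≡ g k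
      lookupTab g Fin.zero = refl
        where import Data.Fin as Fin
      lookupTab g (Fin.suc k) = lookupTab (g ∘ Fin.suc) k
        where import Data.Fin as Fin

    ℭop-cong : ∀ s {xs ys : Vec Column (hatArity s)} →
               (∀ k → lookup xs k ≈c lookup ys k) → ℭop s xs ≈c ℭop s ys
    ℭop-cong d p i = p i i
    ℭop-cong (fhat f is) {xs} {ys} p j with j ≟ I f is
    ... | yes eq = ≈trans (≈≡ (substFst (sym eq) (hatVal f is xs)))
                     (≈trans (op-cong Aa f (λ k → ≈trans (≈≡ (lookupTab _ k))
                                   (≈trans (p k (lookup is k)) (≈sym (≈≡ (lookupTab _ k))))))
                       (≈sym (≈≡ (substFst (sym eq) (hatVal f is ys)))))
    ... | no _ = headCong (nn f) p j

    ℭ : Algebra F̂ a ℓ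
    ℭ = record
      { Carrier       = Column
      ; _≈_           = _≈c_
      ; isEquivalence = record { refl = λ i → ≈refl
                               ; sym = λ p i → IsEquivalence.sym (isEquivalence Aa) (p i)
                               ; trans = λ p q i → IsEquivalence.trans (isEquivalence Aa) (p i) (q i) }
      ; op            = ℭop
      ; op-cong       = ℭop-cong
      }

  ℭmap : ∀ {a ℓ b ℓ'} {A : SliceObj a ℓ} {B : SliceObj b ℓ'} →
         SliceHom A B → Column A → Column B
  ℭmap ψ c i = fun (hom ψ) (proj₁ (c i)) , trans (sym (tri ψ (proj₁ (c i)))) (proj₂ (c i))

  idSlice : ∀ {a ℓ} (A : SliceObj a ℓ) → SliceHom A A
  idSlice A = record
    { hom = record { fun = id ; fun-cong = id
                   ; fun-hom = λ f xs → IsEquivalence.reflexive (isEquivalence (alg A))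
                                          (cong (op (alg A) f) (sym (mapId xs))) }
    ; tri = λ x → refl }
    where
      mapId : ∀ {n} (xs : Vec (Carrier (alg A)) n) → map id xs ≡ xs
      mapId [] = refl
      mapId (x ∷ xs) = cong (x ∷_) (mapId xs)

  compSlice : ∀ {a ℓ b ℓ' c ℓ''} {A : SliceObj a ℓ} {B : SliceObj b ℓ'} {C : SliceObj c ℓ''} →
              SliceHom B C → SliceHom A B → SliceHom A C
  compSlice {A = A} {B} {C} φ ψ = record
    { hom = record
      { fun = fun (hom φ) ∘ fun (hom ψ)
      ; fun-cong = fun-cong (hom φ) ∘ fun-cong (hom ψ)
      ; fun-hom = λ f xs → IsEquivalence.trans (isEquivalence (alg C))
                    (fun-cong (hom φ) (fun-hom (hom ψ) f xs))
                    (IsEquivalence.trans (isEquivalence (alg C))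
                      (fun-hom (hom φ) f (map (fun (hom ψ)) xs))
                      (IsEquivalence.reflexive (isEquivalence (alg C))
                        (cong (op (alg C) f) (sym (map-∘ xs))))) }
    ; tri = λ x → trans (tri ψ x) (tri φ (fun (hom ψ) x)) }
    where
      map-∘ : ∀ {n} (xs : Vec (Carrier (alg A)) n) →
              map (fun (hom φ) ∘ fun (hom ψ)) xs ≡ map (fun (hom φ)) (map (fun (hom ψ)) xs)
      map-∘ [] = refl
      map-∘ (x ∷ xs) = cong (_ ∷_) (map-∘ xs)

  record Corollary (a ℓ : Level) : Set (lsuc (a ⊔ ℓ)) where
    field
      ℭmap-hom : ∀ {A B : SliceObj a ℓ} (ψ : SliceHom A B) → IsHom (ℭ A) (ℭ B) (ℭmap ψ)
      ℭmap-id : ∀ (A : SliceObj a ℓ) → ∀ c → _≈_ (ℭ A) (ℭmap (idSlice A) c) c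
      ℭmap-∘ : ∀ {A B C : SliceObj a ℓ} (φ : SliceHom B C) (ψ : SliceHom A B) →
               ∀ c → _≈_ (ℭ C) (ℭmap (compSlice φ ψ) c) (ℭmap φ (ℭmap ψ c))
      faithful : ∀ {A B : SliceObj a ℓ} (ψ ψ′ : SliceHom A B) →
                 (∀ c → _≈_ (ℭ B) (ℭmap ψ c) (ℭmap ψ′ c)) → ψ ≈ₛ ψ′
      full : ∀ {A B : SliceObj a ℓ} (g : Hom (ℭ A) (ℭ B)) →
             Σ (SliceHom A B) (λ ψ → ∀ c → _≈_ (ℭ B) (ℭmap ψ c) (fun g c))
      ℭ-inD      : ∀ (A : SliceObj a ℓ) → InD (ℭ A)
      ℭ-nonempty : ∀ (A : SliceObj a ℓ) → Column A
      essSurj : ∀ (B : NonemptyD a ℓ) → Σ (SliceObj a ℓ) (λ A → ℭ A ≅ algD B)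

-- A homomorphism g : ℭ(A, χ) → ℭ(B, ξ) commutes with d, and c′ = d_i(c, c′) as soon as
-- the columns c and c′ agree at i; hence g acts fibre by fibre, its action on the fibres
-- is a slice morphism inducing g (fullness), and it is determined by that action because
-- every element lies in some column (faithfulness).  Conversely, in a member B of D with
-- an element e the maps d_i(-, e) separate points, since x = d(d_1(x, e), …, d_m(x, e)).
-- So B is recovered as ℭ of the algebra whose i-th fibre is the image of d_i(-, e),
-- operated on by the f̂_𝐢.

module Submission where

open import Defs
open import Level using (Level)
open import Data.Nat using (ℕ; _<_; suc)
open import Data.Fin using (Fin; _≟_)
open import Data.Vec using (Vec; _∷_; lookup; tabulate; map; replicate; zip; _[_]≔_)
open import Data.Vec.Properties
  using (lookup∘update; lookup∘update′; lookup-map; lookup∘tabulate; tabulate∘lookup;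
         tabulate-∘; tabulate-cong; lookup-replicate; lookup-zip; map-proj₁-zip; map-proj₂-zip)
open import Data.Vec.Relation.Binary.Pointwise.Extensional using (ext; Pointwise-≡⇒≡)
open import Data.Product using (Σ; _,_; proj₁; proj₂; _×_)
open import Data.Empty using (⊥-elim)
open import Function using (_∘_)
open import Relation.Binary.Bundles using (Setoid)
open import Relation.Binary.Structures using (IsEquivalence)
open import Relation.Binary.PropositionalEquality
  using (_≡_; _≢_; refl; sym; trans; cong; cong₂; subst; subst₂; module ≡-Reasoning)
open import Relation.Nullary using (Dec; yes; no)
import Relation.Binary.Reasoning.Setoid as SetoidReasoning

head′-map : ∀ {a b} {A : Set a} {B : Set b} {n} (p : 0 < n) (f : A → B) (xs : Vec A n) →
            head′ p (map f xs) ≡ f (head′ p xs)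
head′-map {n = suc n} p f (x ∷ xs) = refl

lookup-replicate-update′ : ∀ {a} {A : Set a} {n} {j k : Fin n} → j ≢ k → (u x : A) →
                           lookup (replicate n u [ j ]≔ x) k ≡ u
lookup-replicate-update′ {n = n} {j} {k} j≢k u x =
  trans (lookup∘update′ (j≢k ∘ sym) (replicate n u) x) (lookup-replicate k u)

map-tabulate-lookup : ∀ {a b} {A : Set a} {B : Set b} {n} (f : A → B) (xs : Vec A n) →
                      map f xs ≡ tabulate (f ∘ lookup xs)
map-tabulate-lookup f xs =
  trans (cong (map f) (sym (tabulate∘lookup xs))) (sym (tabulate-∘ f (lookup xs)))

op-cong-tabulate : ∀ {F a ℓ} (A : Algebra F a ℓ) s {g h : Fin (arity F s) → Carrier A} →
                   (∀ k → _≈_ A (g k) (h k)) → _≈_ A (op A s (tabulate g)) (op A s (tabulate h))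
op-cong-tabulate A s {g} {h} g≈h = op-cong A s λ k →
  subst₂ (_≈_ A) (sym (lookup∘tabulate g k)) (sym (lookup∘tabulate h k)) (g≈h k)

setoid : ∀ {F a ℓ} → Algebra F a ℓ → Setoid a ℓ
setoid A = record { isEquivalence = isEquivalence A }

module Construction (F : Language) (nn : NoNullary F) (m : ℕ)
                    (I : (f : Sym F) → Vec (Fin m) (arity F f) → Fin m) where
  open Setup F nn m I

  module Columns {a ℓ} (A : SliceObj a ℓ) where
    private
      _≈A_ = _≈_ (alg A)
      open IsEquivalence (isEquivalence (alg A)) using (reflexive) renaming (trans to ≈-trans)

      proj₁-subst : ∀ {i j} (eq : i ≡ j) (x : Fiber A i) →
                    proj₁ (subst (Fiber A) eq x) ≡ proj₁ x
      proj₁-subst refl x = refl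

    ℭ-fhat-on : ∀ f is (cs : Vec (Column A) (arity F f)) →
                proj₁ (ℭop A (fhat f is) cs (I f is)) ≡ op (alg A) f (hatArgs A f is cs)
    ℭ-fhat-on f is cs with I f is ≟ I f is
    ... | yes eq = proj₁-subst (sym eq) (hatVal A f is cs)
    ... | no ne  = ⊥-elim (ne refl)

    ℭ-fhat-off : ∀ f is (cs : Vec (Column A) (arity F f)) {j} → j ≢ I f is →
                 ℭop A (fhat f is) cs j ≡ head′ (nn f) cs j
    ℭ-fhat-off f is cs {j} j≢ with j ≟ I f is
    ... | yes eq = ⊥-elim (j≢ eq)
    ... | no _   = refl

    ℭ-dAt-on : ∀ j (c u : Column A) → dAt (ℭ A) j c u j ≡ c j
    ℭ-dAt-on j c u = cong (λ v → v j) (lookup∘update j (replicate m u) c)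

    ℭ-dAt-off : ∀ {j k} → j ≢ k → (c u : Column A) → dAt (ℭ A) j c u k ≡ u k
    ℭ-dAt-off {k = k} j≢k c u = cong (λ v → v k) (lookup-replicate-update′ j≢k u c)

    ℭ-dAt-local : ∀ j {c c′} (u : Column A) → proj₁ (c j) ≈A proj₁ (c′ j) →
                  _≈_ (ℭ A) (dAt (ℭ A) j c u) (dAt (ℭ A) j c′ u)
    ℭ-dAt-local j {c} {c′} u cj≈c′j k with j ≟ k
    ... | yes refl = ≈-trans (reflexive (cong proj₁ (ℭ-dAt-on j c u)))
                       (≈-trans cj≈c′j (reflexive (cong proj₁ (sym (ℭ-dAt-on j c′ u)))))
    ... | no j≢k   = reflexive (cong proj₁ (trans (ℭ-dAt-off j≢k c u)
                                                  (sym (ℭ-dAt-off j≢k c′ u))))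

    ℭ-dAt-absorb : ∀ j (c u : Column A) → proj₁ (c j) ≈A proj₁ (u j) →
                   _≈_ (ℭ A) (dAt (ℭ A) j c u) u
    ℭ-dAt-absorb j c u cj≈uj k with j ≟ k
    ... | yes refl = ≈-trans (reflexive (cong proj₁ (ℭ-dAt-on j c u))) cj≈uj
    ... | no j≢k   = reflexive (cong proj₁ (ℭ-dAt-off j≢k c u))

    dAts : ∀ {n} → Vec (Fin m) n → Vec (Column A) n → Vec (Column A) n → Vec (Column A) n
    dAts is cs vs = tabulate (λ k → dAt (ℭ A) (lookup is k) (lookup cs k) (lookup vs k))

    hatArgs-dAts : ∀ f is (cs vs : Vec (Column A) (arity F f)) →
                   hatArgs A f is (dAts is cs vs) ≡ hatArgs A f is cs
    hatArgs-dAts f is cs vs = tabulate-cong λ k → begin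
      proj₁ (lookup (dAts is cs vs) k (lookup is k))
        ≡⟨ cong (λ c → proj₁ (c (lookup is k)))
                (lookup∘tabulate (λ k → dAt (ℭ A) (lookup is k) (lookup cs k) (lookup vs k)) k) ⟩
      proj₁ (dAt (ℭ A) (lookup is k) (lookup cs k) (lookup vs k) (lookup is k))
        ≡⟨ cong proj₁ (ℭ-dAt-on (lookup is k) (lookup cs k) (lookup vs k)) ⟩
      proj₁ (lookup cs k (lookup is k)) ∎
      where open ≡-Reasoning

    ℭ-inD : InD (ℭ A)
    ℭ-inD = record
      { idem      = λ c k → reflexive (cong (λ v → proj₁ (v k)) (lookup-replicate k c))
      ; diag      = λ X k → reflexive (trans
                      (cong (λ v → proj₁ (v k)) (lookup-map k (ℭop A d) X))
                      (cong (λ v → proj₁ (v k))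
                            (sym (lookup∘tabulate (λ i → lookup (lookup X i) i) k))))
      ; hat-main  = λ f is cs vs u → ℭ-dAt-local (I f is) u (reflexive (begin
          proj₁ (ℭop A (fhat f is) cs (I f is))
            ≡⟨ ℭ-fhat-on f is cs ⟩
          op (alg A) f (hatArgs A f is cs)
            ≡⟨ cong (op (alg A) f) (hatArgs-dAts f is cs vs) ⟨
          op (alg A) f (hatArgs A f is (dAts is cs vs))
            ≡⟨ ℭ-fhat-on f is (dAts is cs vs) ⟨
          proj₁ (ℭop A (fhat f is) (dAts is cs vs) (I f is)) ∎))
      ; hat-other = λ f is j j≢ cs u →
          ℭ-dAt-local j u (reflexive (cong proj₁ (ℭ-fhat-off f is cs j≢)))
      }
      where open ≡-Reasoning

    column-through : Carrier (alg A) → Column A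
    column-through x i with i ≟ χ A x
    ... | yes eq = x , sym eq
    ... | no _   = χ-surj A i

    column-through-at : ∀ x → proj₁ (column-through x (χ A x)) ≡ x
    column-through-at x with χ A x ≟ χ A x
    ... | yes _ = refl
    ... | no ne = ⊥-elim (ne refl)

    hatArgs-through : ∀ f (xs : Vec (Carrier (alg A)) (arity F f)) →
                      hatArgs A f (map (χ A) xs) (map column-through xs) ≡ xs
    hatArgs-through f xs = Pointwise-≡⇒≡ (ext λ k → begin
      lookup (hatArgs A f (map (χ A) xs) (map column-through xs)) k
        ≡⟨ lookup∘tabulate _ k ⟩
      proj₁ (lookup (map column-through xs) k (lookup (map (χ A) xs) k))
        ≡⟨ cong₂ (λ c i → proj₁ (c i)) (lookup-map k column-through xs) (lookup-map k (χ A) xs) ⟩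
      proj₁ (column-through (lookup xs k) (χ A (lookup xs k)))
        ≡⟨ column-through-at (lookup xs k) ⟩
      lookup xs k ∎)
      where open ≡-Reasoning

  module Functor {a ℓ} {A B : SliceObj a ℓ} where
    open Columns
    private
      _≈A_ = _≈_ (alg A)
      _≈B_ = _≈_ (alg B)
      module ≈A = IsEquivalence (isEquivalence (alg A))
      module ≈B = IsEquivalence (isEquivalence (alg B))
      open SetoidReasoning (setoid (alg B))

    hatArgs-ℭmap : (ψ : SliceHom A B) → ∀ f is (cs : Vec (Column A) (arity F f)) →
                   map (fun (hom ψ)) (hatArgs A f is cs) ≡ hatArgs B f is (map (ℭmap ψ) cs)
    hatArgs-ℭmap ψ f is cs = trans (sym (tabulate-∘ (fun (hom ψ)) _)) (tabulate-cong λ k →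
      cong (λ c → proj₁ (c (lookup is k))) (sym (lookup-map k (ℭmap ψ) cs)))

    ℭmap-hom : (ψ : SliceHom A B) → IsHom (ℭ A) (ℭ B) (ℭmap ψ)
    ℭmap-hom ψ = (λ c≈c′ i → fun-cong (hom ψ) (c≈c′ i)) , commutes
      where
      ψ₀ = fun (hom ψ)
      commutes : ∀ s cs → _≈_ (ℭ B) (ℭmap ψ (ℭop A s cs)) (ℭop B s (map (ℭmap ψ) cs))
      commutes d cs i = ≈B.reflexive (cong (λ c → proj₁ (c i)) (sym (lookup-map i (ℭmap ψ) cs)))
      commutes (fhat f is) cs j = by-position j (j ≟ I f is)
        where
        -- A case split by `with` would also abstract the test j ≟ I f is inside ℭop.
        by-position : ∀ j → Dec (j ≡ I f is) →
                      ψ₀ (proj₁ (ℭop A (fhat f is) cs j))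
                        ≈B proj₁ (ℭop B (fhat f is) (map (ℭmap ψ) cs) j)
        by-position _ (yes refl) = begin
          ψ₀ (proj₁ (ℭop A (fhat f is) cs (I f is)))
            ≡⟨ cong ψ₀ (ℭ-fhat-on A f is cs) ⟩
          ψ₀ (op (alg A) f (hatArgs A f is cs))
            ≈⟨ fun-hom (hom ψ) f _ ⟩
          op (alg B) f (map ψ₀ (hatArgs A f is cs))
            ≡⟨ cong (op (alg B) f) (hatArgs-ℭmap ψ f is cs) ⟩
          op (alg B) f (hatArgs B f is (map (ℭmap ψ) cs))
            ≡⟨ ℭ-fhat-on B f is _ ⟨
          proj₁ (ℭop B (fhat f is) (map (ℭmap ψ) cs) (I f is)) ∎
        by-position j (no j≢) = begin
          ψ₀ (proj₁ (ℭop A (fhat f is) cs j))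
            ≡⟨ cong (ψ₀ ∘ proj₁) (ℭ-fhat-off A f is cs j≢) ⟩
          ψ₀ (proj₁ (head′ (nn f) cs j))
            ≡⟨ cong (λ c → proj₁ (c j)) (head′-map (nn f) (ℭmap ψ) cs) ⟨
          proj₁ (head′ (nn f) (map (ℭmap ψ) cs) j)
            ≡⟨ cong proj₁ (ℭ-fhat-off B f is _ j≢) ⟨
          proj₁ (ℭop B (fhat f is) (map (ℭmap ψ) cs) j) ∎

    faithful : (ψ ψ′ : SliceHom A B) → (∀ c → _≈_ (ℭ B) (ℭmap ψ c) (ℭmap ψ′ c)) →
               ψ ≈ₛ ψ′
    faithful ψ ψ′ agree x =
      subst (λ z → fun (hom ψ) z ≈B fun (hom ψ′) z) (column-through-at A x)
            (agree (column-through A x) (χ A x))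

    hom-fibrewise : (g : Hom (ℭ A) (ℭ B)) {c c′ : Column A} (i : Fin m) →
                    proj₁ (c i) ≈A proj₁ (c′ i) → proj₁ (fun g c i) ≈B proj₁ (fun g c′ i)
    hom-fibrewise g {c} {c′} i ci≈c′i = begin
      proj₁ (fun g c i)                    ≡⟨ cong (λ c → proj₁ (c i)) g-at-i ⟨
      proj₁ (ℭop B d (map (fun g) v) i)    ≈⟨ fun-hom g d v i ⟨
      proj₁ (fun g (dAt (ℭ A) i c c′) i)   ≈⟨ fun-cong g (ℭ-dAt-absorb A i c c′ ci≈c′i) i ⟩
      proj₁ (fun g c′ i)                   ∎
      where
      v = replicate m c′ [ i ]≔ c
      g-at-i : lookup (map (fun g) v) i ≡ fun g c
      g-at-i = trans (lookup-map i (fun g) v) (cong (fun g) (lookup∘update i (replicate m c′) c))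

    module Full (g : Hom (ℭ A) (ℭ B)) where
      ψ₀ : Carrier (alg A) → Carrier (alg B)
      ψ₀ x = proj₁ (fun g (column-through A x) (χ A x))

      fibre-value : ∀ {x i} → χ A x ≡ i → (c : Column A) → proj₁ (c i) ≈A x →
                    proj₁ (fun g c i) ≈B ψ₀ x
      fibre-value {x} refl c ci≈x =
        hom-fibrewise g (χ A x) (≈A.trans ci≈x (≈A.reflexive (sym (column-through-at A x))))

      ψ₀-cong : ∀ {x y} → x ≈A y → ψ₀ x ≈B ψ₀ y
      ψ₀-cong {x} {y} x≈y = ≈B.sym (fibre-value (χ-cong A x≈y) (column-through A y)
                              (≈A.trans (≈A.reflexive (column-through-at A y)) (≈A.sym x≈y)))

      ψ₀-hom : ∀ f (xs : Vec (Carrier (alg A)) (arity F f)) →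
               ψ₀ (op (alg A) f xs) ≈B op (alg B) f (map ψ₀ xs)
      ψ₀-hom f xs = begin
        ψ₀ (op (alg A) f xs)
          ≈⟨ fibre-value (χ-hom A f xs) (ℭop A (fhat f is) cs) value ⟨
        proj₁ (fun g (ℭop A (fhat f is) cs) (I f is))
          ≈⟨ fun-hom g (fhat f is) cs (I f is) ⟩
        proj₁ (ℭop B (fhat f is) (map (fun g) cs) (I f is))
          ≡⟨ ℭ-fhat-on B f is _ ⟩
        op (alg B) f (hatArgs B f is (map (fun g) cs))
          ≡⟨ cong (op (alg B) f) args ⟩
        op (alg B) f (map ψ₀ xs) ∎
        where
        is = map (χ A) xs
        cs = map (column-through A) xs
        value : proj₁ (ℭop A (fhat f is) cs (I f is)) ≈A op (alg A) f xs
        value = ≈A.reflexive (trans (ℭ-fhat-on A f is cs)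
                                    (cong (op (alg A) f) (hatArgs-through A f xs)))
        args : hatArgs B f is (map (fun g) cs) ≡ map ψ₀ xs
        args = trans (tabulate-cong λ k → cong₂ (λ c i → proj₁ (c i))
                        (trans (lookup-map k (fun g) cs)
                               (cong (fun g) (lookup-map k (column-through A) xs)))
                        (lookup-map k (χ A) xs))
                     (sym (map-tabulate-lookup ψ₀ xs))

      ψ : SliceHom A B
      ψ = record { hom = record { fun = ψ₀ ; fun-cong = ψ₀-cong ; fun-hom = ψ₀-hom }
                 ; tri = λ x → sym (proj₂ (fun g (column-through A x) (χ A x))) }

      ℭmap-ψ : ∀ c → _≈_ (ℭ B) (ℭmap ψ c) (fun g c)
      ℭmap-ψ c i = ≈B.sym (fibre-value (proj₂ (c i)) c ≈A.refl)

    full : (g : Hom (ℭ A) (ℭ B)) →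
           Σ (SliceHom A B) (λ ψ → ∀ c → _≈_ (ℭ B) (ℭmap ψ c) (fun g c))
    full g = Full.ψ g , Full.ℭmap-ψ g

  module Decomposition {b ℓ′} (B : Algebra F̂ b ℓ′) (B∈D : InD B) (e : Carrier B) where
    open InD B∈D
    private
      _≈B_ = _≈_ B
      module ≈B = IsEquivalence (isEquivalence B)
      open SetoidReasoning (setoid B)

    component : Fin m → Carrier B → Carrier B
    component i x = dAt B i x e

    dAt-cong : ∀ j {x x′} u → x ≈B x′ → dAt B j x u ≈B dAt B j x′ u
    dAt-cong j {x} {x′} u x≈x′ = op-cong B d pointwise
      where
      pointwise : ∀ k → lookup (replicate m u [ j ]≔ x) k ≈B lookup (replicate m u [ j ]≔ x′) k
      pointwise k with j ≟ k
      ... | yes refl = ≈B.trans (≈B.reflexive (lookup∘update j (replicate m u) x))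
                         (≈B.trans x≈x′ (≈B.reflexive (sym (lookup∘update j (replicate m u) x′))))
      ... | no j≢k   = ≈B.reflexive (trans (lookup-replicate-update′ j≢k u x)
                                           (sym (lookup-replicate-update′ j≢k u x′)))

    component-d : ∀ i (xs : Vec (Carrier B) m) →
                  component i (op B d xs) ≈B component i (lookup xs i)
    component-d i xs = begin
      op B d (replicate m e [ i ]≔ op B d xs)           ≈⟨ op-cong B d rows ⟩
      op B d (map (op B d) X)                           ≈⟨ diag X ⟩
      op B d (tabulate (λ k → lookup (lookup X k) k))   ≈⟨ op-cong B d diagonal ⟩
      op B d (replicate m e [ i ]≔ lookup xs i)         ∎
      where
      es = replicate m e
      X = replicate m es [ i ]≔ xs
      row : ∀ k → lookup (map (op B d) X) k ≡ op B d (lookup X k)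
      row k = lookup-map k (op B d) X
      rows : ∀ k → lookup (es [ i ]≔ op B d xs) k ≈B lookup (map (op B d) X) k
      rows k with i ≟ k
      ... | yes refl = ≈B.reflexive (trans (lookup∘update i es (op B d xs))
                         (sym (trans (row i) (cong (op B d) (lookup∘update i (replicate m es) xs)))))
      ... | no i≢k   = ≈B.trans (≈B.reflexive (lookup-replicate-update′ i≢k e _))
                         (≈B.trans (≈B.sym (idem e)) (≈B.reflexive (sym
                           (trans (row k) (cong (op B d) (lookup-replicate-update′ i≢k es xs))))))
      diagonal : ∀ k → lookup (tabulate (λ k → lookup (lookup X k) k)) k
                         ≈B lookup (es [ i ]≔ lookup xs i) k
      diagonal k with i ≟ k
      ... | yes refl = ≈B.reflexive (trans (lookup∘tabulate _ i)
                         (trans (cong (λ r → lookup r i) (lookup∘update i (replicate m es) xs))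
                           (sym (lookup∘update i es (lookup xs i)))))
      ... | no i≢k   = ≈B.reflexive (trans (lookup∘tabulate _ k)
                         (trans (cong (λ r → lookup r k) (lookup-replicate-update′ i≢k es xs))
                           (trans (lookup-replicate k e) (sym (lookup-replicate-update′ i≢k e _)))))

    decompose : ∀ x → x ≈B op B d (tabulate (λ i → component i x))
    decompose x = begin
      x                                                ≈⟨ idem x ⟨
      op B d (replicate m x)                           ≈⟨ op-cong B d diagonal ⟩
      op B d (tabulate (λ i → lookup (lookup X i) i))  ≈⟨ diag X ⟨
      op B d (map (op B d) X)                          ≡⟨ cong (op B d) (tabulate-∘ (op B d) row) ⟨
      op B d (tabulate (λ i → component i x))          ∎
      where
      row = λ i → replicate m e [ i ]≔ x
      X = tabulate row
      diagonal : ∀ k → lookup (replicate m x) k ≈B lookup (tabulate (λ i → lookup (lookup X i) i)) k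
      diagonal k = ≈B.reflexive (trans (lookup-replicate k x) (sym
        (trans (lookup∘tabulate _ k)
          (trans (cong (λ r → lookup r k) (lookup∘tabulate row k))
                 (lookup∘update k (replicate m e) x)))))

    ≈-by-components : ∀ {x y} → (∀ i → component i x ≈B component i y) → x ≈B y
    ≈-by-components {x} {y} x≈y = begin
      x                                        ≈⟨ decompose x ⟩
      op B d (tabulate (λ i → component i x))  ≈⟨ op-cong-tabulate B d x≈y ⟩
      op B d (tabulate (λ i → component i y))  ≈⟨ decompose y ⟨
      y                                        ∎

    component-fhat-cong : ∀ f is (xs ys : Vec (Carrier B) (arity F f)) →
                          (∀ k → component (lookup is k) (lookup xs k)
                                   ≈B component (lookup is k) (lookup ys k)) →
                          component (I f is) (op B (fhat f is) xs)
                            ≈B component (I f is) (op B (fhat f is) ys)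
    component-fhat-cong f is xs ys xs≈ys = begin
      component (I f is) (op B (fhat f is) xs)
        ≈⟨ hat-main f is xs es e ⟩
      component (I f is) (op B (fhat f is) (localise xs))
        ≡⟨ cong (component (I f is)) (localised xs) ⟩
      component (I f is) (op B (fhat f is) (components xs))
        ≈⟨ dAt-cong (I f is) e (op-cong-tabulate B (fhat f is) xs≈ys) ⟩
      component (I f is) (op B (fhat f is) (components ys))
        ≡⟨ cong (component (I f is)) (localised ys) ⟨
      component (I f is) (op B (fhat f is) (localise ys))
        ≈⟨ hat-main f is ys es e ⟨
      component (I f is) (op B (fhat f is) ys) ∎
      where
      es = replicate (arity F f) e
      localise components : Vec (Carrier B) (arity F f) → Vec (Carrier B) (arity F f)
      localise zs   = tabulate (λ k → dAt B (lookup is k) (lookup zs k) (lookup es k))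
      components zs = tabulate (λ k → component (lookup is k) (lookup zs k))
      localised : ∀ zs → op B (fhat f is) (localise zs) ≡ op B (fhat f is) (components zs)
      localised zs = cong (op B (fhat f is)) (tabulate-cong λ k →
        cong (dAt B (lookup is k) (lookup zs k)) (lookup-replicate k e))

  module Reconstruction {a ℓ} (N : NonemptyD a ℓ) where
    private
      B = algD N
      e = inhabited N
      _≈B_ = _≈_ B
      module ≈B = IsEquivalence (isEquivalence B)
      module ≈B-Reasoning = SetoidReasoning (setoid B)
    open Decomposition B (inD N) e
    open InD (inD N) using (hat-other)
    open Columns

    -- (i , x) stands for the element d_i(x, e) of the i-th fibre.
    _∼_ : Fin m × Carrier B → Fin m × Carrier B → Set ℓ
    (i , x) ∼ (j , y) = i ≡ j × component i x ≈B component i y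

    ∼-isEquivalence : IsEquivalence _∼_
    ∼-isEquivalence = record
      { refl  = refl , ≈B.refl
      ; sym   = λ { (refl , p) → refl , ≈B.sym p }
      ; trans = λ { (refl , p) (refl , q) → refl , ≈B.trans p q }
      }

    stalkOp : (f : Sym F) → Vec (Fin m × Carrier B) (arity F f) → Fin m × Carrier B
    stalkOp f xs = I f (map proj₁ xs) , op B (fhat f (map proj₁ xs)) (map proj₂ xs)

    stalkOp-cong : ∀ f {xs ys} → (∀ k → lookup xs k ∼ lookup ys k) → stalkOp f xs ∼ stalkOp f ys
    stalkOp-cong f {xs} {ys} xs∼ys = cong (I f) indices , (begin
      component (I f is) (op B (fhat f is) (map proj₂ xs))
        ≈⟨ component-fhat-cong f is _ _ values ⟩
      component (I f is) (op B (fhat f is) (map proj₂ ys))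
        ≡⟨ cong (λ is′ → component (I f is) (op B (fhat f is′) (map proj₂ ys))) indices ⟩
      component (I f is) (op B (fhat f (map proj₁ ys)) (map proj₂ ys)) ∎)
      where
      open ≈B-Reasoning
      is = map proj₁ xs
      indices : is ≡ map proj₁ ys
      indices = Pointwise-≡⇒≡ (ext λ k →
        trans (lookup-map k proj₁ xs) (trans (proj₁ (xs∼ys k)) (sym (lookup-map k proj₁ ys))))
      values : ∀ k → component (lookup is k) (lookup (map proj₂ xs) k)
                       ≈B component (lookup is k) (lookup (map proj₂ ys) k)
      values k rewrite lookup-map k proj₁ xs | lookup-map k proj₂ xs | lookup-map k proj₂ ys =
        proj₂ (xs∼ys k)

    stalkAlgebra : Algebra F a ℓ
    stalkAlgebra = record
      { Carrier       = Fin m × Carrier B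
      ; _≈_           = _∼_
      ; isEquivalence = ∼-isEquivalence
      ; op            = stalkOp
      ; op-cong       = stalkOp-cong
      }

    stalks : SliceObj a ℓ
    stalks = record
      { alg    = stalkAlgebra
      ; χ      = proj₁
      ; χ-cong = proj₁
      ; χ-hom  = λ f xs → refl
      ; χ-surj = λ i → (i , e) , refl
      }

    entry : Column stalks → Fin m → Carrier B
    entry c i = proj₂ (proj₁ (c i))

    component-entry-cong : ∀ i (x y : Fiber stalks i) → proj₁ x ∼ proj₁ y →
                           component i (proj₂ (proj₁ x)) ≈B component i (proj₂ (proj₁ y))
    component-entry-cong i ((_ , _) , refl) ((_ , _) , refl) (_ , p) = p

    ∼-entry : ∀ i (x : Fiber stalks i) y → component i y ≈B component i (proj₂ (proj₁ x)) →
              (i , y) ∼ proj₁ x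
    ∼-entry i ((_ , _) , refl) y p = refl , p

    fibre-indices : ∀ f is (cs : Vec (Column stalks) (arity F f)) →
                    map proj₁ (hatArgs stalks f is cs) ≡ is
    fibre-indices f is cs = Pointwise-≡⇒≡ (ext λ k →
      trans (lookup-map k proj₁ (hatArgs stalks f is cs))
        (trans (cong proj₁ (lookup∘tabulate (λ k → proj₁ (lookup cs k (lookup is k))) k))
          (proj₂ (lookup cs k (lookup is k)))))

    glue : Column stalks → Carrier B
    glue c = op B d (tabulate (entry c))

    component-glue : ∀ c i → component i (glue c) ≈B component i (entry c i)
    component-glue c i = ≈B.trans (component-d i (tabulate (entry c)))
                           (≈B.reflexive (cong (component i) (lookup∘tabulate (entry c) i)))

    glue-cong : ∀ {c c′ : Column stalks} → _≈_ (ℭ stalks) c c′ → glue c ≈B glue c′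
    glue-cong {c} {c′} c≈c′ = ≈-by-components λ i → begin
      component i (glue c)       ≈⟨ component-glue c i ⟩
      component i (entry c i)    ≈⟨ component-entry-cong i (c i) (c′ i) (c≈c′ i) ⟩
      component i (entry c′ i)   ≈⟨ component-glue c′ i ⟨
      component i (glue c′)      ∎
      where open ≈B-Reasoning

    glue-hom : ∀ s cs → glue (ℭop stalks s cs) ≈B op B s (map glue cs)
    glue-hom d cs = ≈-by-components λ i → begin
      component i (glue (ℭop stalks d cs))  ≈⟨ component-glue (ℭop stalks d cs) i ⟩
      component i (entry (lookup cs i) i)   ≈⟨ component-glue (lookup cs i) i ⟨
      component i (glue (lookup cs i))      ≡⟨ cong (component i) (lookup-map i glue cs) ⟨
      component i (lookup (map glue cs) i)  ≈⟨ component-d i (map glue cs) ⟨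
      component i (op B d (map glue cs))    ∎
      where open ≈B-Reasoning
    glue-hom (fhat f is) cs = ≈-by-components λ j →
      ≈B.trans (component-glue c₀ j) (by-position j (j ≟ I f is))
      where
      open ≈B-Reasoning
      c₀ = ℭop stalks (fhat f is) cs
      args = hatArgs stalks f is cs
      values : ∀ k → component (lookup is k) (lookup (map proj₂ args) k)
                       ≈B component (lookup is k) (lookup (map glue cs) k)
      values k = begin
        component (lookup is k) (lookup (map proj₂ args) k)
          ≡⟨ cong (component (lookup is k)) (trans (lookup-map k proj₂ args)
               (cong proj₂ (lookup∘tabulate (λ k → proj₁ (lookup cs k (lookup is k))) k))) ⟩
        component (lookup is k) (entry (lookup cs k) (lookup is k))
          ≈⟨ component-glue (lookup cs k) (lookup is k) ⟨
        component (lookup is k) (glue (lookup cs k))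
          ≡⟨ cong (component (lookup is k)) (lookup-map k glue cs) ⟨
        component (lookup is k) (lookup (map glue cs) k) ∎
      by-position : ∀ j → Dec (j ≡ I f is) →
                    component j (entry c₀ j) ≈B component j (op B (fhat f is) (map glue cs))
      by-position _ (yes refl) = begin
        component (I f is) (entry c₀ (I f is))
          ≡⟨ cong (component (I f is) ∘ proj₂) (ℭ-fhat-on stalks f is cs) ⟩
        component (I f is) (op B (fhat f (map proj₁ args)) (map proj₂ args))
          ≡⟨ cong (λ is′ → component (I f is) (op B (fhat f is′) (map proj₂ args)))
                  (fibre-indices f is cs) ⟩
        component (I f is) (op B (fhat f is) (map proj₂ args))
          ≈⟨ component-fhat-cong f is _ _ values ⟩
        component (I f is) (op B (fhat f is) (map glue cs)) ∎
      by-position j (no j≢) = begin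
        component j (entry c₀ j)
          ≡⟨ cong (λ c → component j (proj₂ (proj₁ c))) (ℭ-fhat-off stalks f is cs j≢) ⟩
        component j (entry (head′ (nn f) cs) j)
          ≈⟨ component-glue (head′ (nn f) cs) j ⟨
        component j (glue (head′ (nn f) cs))
          ≡⟨ cong (component j) (head′-map (nn f) glue cs) ⟨
        component j (head′ (nn f) (map glue cs))
          ≈⟨ hat-other f is j j≢ (map glue cs) e ⟨
        component j (op B (fhat f is) (map glue cs)) ∎

    column : Carrier B → Column stalks
    column x i = (i , x) , refl

    column-cong : ∀ {x y} → x ≈B y → _≈_ (ℭ stalks) (column x) (column y)
    column-cong x≈y i = refl , dAt-cong i e x≈y

    hatArgs-column : ∀ f is (xs : Vec (Carrier B) (arity F f)) →
                     hatArgs stalks f is (map column xs) ≡ zip is xs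
    hatArgs-column f is xs = Pointwise-≡⇒≡ (ext λ k →
      trans (lookup∘tabulate (λ k → proj₁ (lookup (map column xs) k (lookup is k))) k)
        (trans (cong (λ c → proj₁ (c (lookup is k))) (lookup-map k column xs))
               (sym (lookup-zip k is xs))))

    column-hom : ∀ s xs → _≈_ (ℭ stalks) (column (op B s xs)) (ℭop stalks s (map column xs))
    column-hom d xs i = begin
      (i , op B d xs)                      ≈⟨ refl , component-d i xs ⟩
      (i , lookup xs i)                    ≡⟨ cong (λ c → proj₁ (c i)) (lookup-map i column xs) ⟨
      proj₁ (lookup (map column xs) i i)   ∎
      where open SetoidReasoning (setoid stalkAlgebra)
    column-hom (fhat f is) xs j = by-position j (j ≟ I f is)
      where
      open SetoidReasoning (setoid stalkAlgebra)
      by-position : ∀ j → Dec (j ≡ I f is) →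
                    (j , op B (fhat f is) xs) ∼ proj₁ (ℭop stalks (fhat f is) (map column xs) j)
      by-position _ (yes refl) = begin
        (I f is , op B (fhat f is) xs)
          ≡⟨ cong₂ (λ is′ xs′ → I f is′ , op B (fhat f is′) xs′)
                   (map-proj₁-zip is xs) (map-proj₂-zip is xs) ⟨
        stalkOp f (zip is xs)
          ≡⟨ cong (stalkOp f) (hatArgs-column f is xs) ⟨
        stalkOp f (hatArgs stalks f is (map column xs))
          ≡⟨ ℭ-fhat-on stalks f is (map column xs) ⟨
        proj₁ (ℭop stalks (fhat f is) (map column xs) (I f is)) ∎
      by-position j (no j≢) = begin
        (j , op B (fhat f is) xs)
          ≈⟨ refl , hat-other f is j j≢ xs e ⟩
        (j , head′ (nn f) xs)
          ≡⟨ cong (λ c → proj₁ (c j)) (head′-map (nn f) column xs) ⟨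
        proj₁ (head′ (nn f) (map column xs) j)
          ≡⟨ cong proj₁ (ℭ-fhat-off stalks f is (map column xs) j≢) ⟨
        proj₁ (ℭop stalks (fhat f is) (map column xs) j) ∎

    ℭ-stalks≅ : ℭ stalks ≅ B
    ℭ-stalks≅ = record
      { to      = record { fun = glue ; fun-cong = λ {c} {c′} → glue-cong {c} {c′}
                         ; fun-hom = glue-hom }
      ; from    = record { fun = column ; fun-cong = column-cong ; fun-hom = column-hom }
      ; from∘to = λ c i → ∼-entry i (c i) (glue c) (component-glue c i)
      ; to∘from = λ x → ≈-by-components (component-glue (column x))
      }

corollary2p8 : (F : Language) (nn : NoNullary F) (m : ℕ) → 0 < m →
    (I : (f : Sym F) → Vec (Fin m) (arity F f) → Fin m) →
    (a ℓ : Level) → Setup.Corollary F nn m I a ℓ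
corollary2p8 F nn m _ I a ℓ = record
  { ℭmap-hom   = ℭmap-hom
  ; ℭmap-id    = λ A c i → IsEquivalence.refl (isEquivalence (alg A))
  ; ℭmap-∘     = λ {C = C} φ ψ c i → IsEquivalence.refl (isEquivalence (alg C))
  ; faithful   = faithful
  ; full       = full
  ; ℭ-inD      = ℭ-inD
  ; ℭ-nonempty = λ A → χ-surj A
  ; essSurj    = λ N → stalks N , ℭ-stalks≅ N
  }
  where
  open Setup F nn m I
  open Construction F nn m I
  open Columns using (ℭ-inD)
  open Functor
  open Reconstruction using (stalks; ℭ-stalks≅)
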